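{- For every integer $n\ge1$, $$\sum_{k=1}^{n}\frac{k!}{n^k}\le 1.$$ -}

module Defs where

open import Data.Nat using (ℕ; zero; suc; _^_; NonZero; _!)
open import Data.Nat.Properties using (m^n≢0)
open import Data.Integer using (+_)
open import Data.Rational using (ℚ; _/_; _+_; 0ℚ)

term : (n : ℕ) → .{{_ : NonZero n}} → ℕ → ℚ
term n k = (+ (k !)) / (n ^ k) where instance _ = m^n≢0 n k

partialSum : (n : ℕ) → .{{_ : NonZero n}} → ℕ → ℚ
partialSum n zero = 0ℚ
partialSum n (suc m) = partialSum n m + term n (suc m)

-- Writing Σ_{k=1}^{m} k!/n^k = A_m / n^m with A_m = n A_{m-1} + m!, the quantity
-- n A_m + (m+1)! (n - m) never exceeds n^{m+1} for m < n: at m = 0 it equals n, and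
-- passing from m to m+1 multiplies the bound by n while the left side grows by at most
-- that factor, because (m+2) (m+1)! (n-m-1) ≤ n (m+1)! (n-m-1).  At m = n-1 the left
-- side is n A_{n-1} + n! = A_n, so A_n ≤ n^n.
module Submission where

open import Defs
open import Data.Nat using (ℕ; NonZero)
open import Data.Rational using (_≤_; 1ℚ)

open import Data.Nat as ℕ using (zero; suc; _!; _^_; z<s)
import Data.Nat.Properties as ℕ
open import Data.Nat.Tactic.RingSolver using (solve; solve-∀)
open import Data.Integer as ℤ using (+_)
import Data.Integer.Properties as ℤ
open import Data.Rational using (toℚᵘ; _/_; _+_)
open import Data.Rational.Properties using (toℚᵘ-fromℚᵘ; toℚᵘ-homo-+; toℚᵘ-cancel-≤)
open import Data.Rational.Unnormalised as U using (mkℚᵘ; _≃_; *≤*)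
import Data.Rational.Unnormalised.Properties as U
open import Data.List using ([]; _∷_)
open import Relation.Binary.PropositionalEquality

toℚᵘ-/ : ∀ i d .{{_ : NonZero d}} → toℚᵘ (i / d) ≃ i U./ d
toℚᵘ-/ i (suc d) = toℚᵘ-fromℚᵘ (mkℚᵘ i d)

+a/d++b/[n*d]≃+[n*a+b]/[n*d] : ∀ a b d n .{{_ : NonZero d}} .{{_ : NonZero (n ℕ.* d)}} →
  (+ a) U./ d U.+ (+ b) U./ (n ℕ.* d) ≃ (+ (n ℕ.* a ℕ.+ b)) U./ (n ℕ.* d)
+a/d++b/[n*d]≃+[n*a+b]/[n*d] a b d@(suc _) n@(suc _) =
  U.≃-trans (U.≃-reflexive (U./-cong (numerators a b d n) (ℕ.*-comm d (n ℕ.* d))))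
            (U.*-cancelʳ-/ d)
  where
  numerators : ∀ a b d n → + a ℤ.* + (n ℕ.* d) ℤ.+ + b ℤ.* + d ≡ + (n ℕ.* a ℕ.+ b) ℤ.* + d
  numerators a b d n = begin
    + a ℤ.* + (n ℕ.* d) ℤ.+ + b ℤ.* + d
      ≡⟨ cong₂ ℤ._+_ (ℤ.pos-* a (n ℕ.* d)) (ℤ.pos-* b d) ⟨
    + (a ℕ.* (n ℕ.* d)) ℤ.+ + (b ℕ.* d)
      ≡⟨ ℤ.pos-+ (a ℕ.* (n ℕ.* d)) (b ℕ.* d) ⟨
    + (a ℕ.* (n ℕ.* d) ℕ.+ b ℕ.* d)
      ≡⟨ cong +_ (solve (a ∷ b ∷ d ∷ n ∷ [])) ⟩
    + ((n ℕ.* a ℕ.+ b) ℕ.* d)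
      ≡⟨ ℤ.pos-* (n ℕ.* a ℕ.+ b) d ⟩
    + (n ℕ.* a ℕ.+ b) ℤ.* + d ∎
    where open ≡-Reasoning

partialSumNumerator : ℕ → ℕ → ℕ
partialSumNumerator n zero    = 0
partialSumNumerator n (suc m) = n ℕ.* partialSumNumerator n m ℕ.+ suc m !

toℚᵘ-partialSum : ∀ n .{{_ : NonZero n}} m →
  toℚᵘ (partialSum n m) ≃ ((+ partialSumNumerator n m) U./ (n ^ m)) {{ℕ.m^n≢0 n m}}
toℚᵘ-partialSum n zero    = U.≃-refl
toℚᵘ-partialSum n (suc m) = begin-equality
  toℚᵘ (partialSum n m + term n (suc m))
    ≃⟨ toℚᵘ-homo-+ (partialSum n m) (term n (suc m)) ⟩
  toℚᵘ (partialSum n m) U.+ toℚᵘ (term n (suc m))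
    ≃⟨ U.+-cong (toℚᵘ-partialSum n m) (toℚᵘ-/ (+ (suc m !)) (n ^ suc m)) ⟩
  (+ partialSumNumerator n m) U./ (n ^ m) U.+ (+ (suc m !)) U./ (n ^ suc m)
    ≃⟨ +a/d++b/[n*d]≃+[n*a+b]/[n*d] (partialSumNumerator n m) (suc m !) (n ^ m) n ⟩
  (+ partialSumNumerator n (suc m)) U./ (n ^ suc m) ∎
  where
  open U.≤-Reasoning
  instance
    _ = ℕ.m^n≢0 n m
    _ = ℕ.m^n≢0 n (suc m)

partialSumNumerator-potential-≤ : ∀ n m d → m ℕ.+ suc d ≡ n →
  partialSumNumerator n m ℕ.* n ℕ.+ suc m ! ℕ.* suc d ℕ.≤ n ^ suc m
partialSumNumerator-potential-≤ _ zero d refl =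
  ℕ.≤-reflexive (trans (ℕ.*-identityˡ (suc d)) (sym (ℕ.*-identityʳ (suc d))))
partialSumNumerator-potential-≤ n (suc m) d eq = begin
  (n ℕ.* A ℕ.+ f) ℕ.* n ℕ.+ (suc (suc m) ℕ.* f) ℕ.* suc d
    ≤⟨ ℕ.+-monoʳ-≤ ((n ℕ.* A ℕ.+ f) ℕ.* n) (ℕ.*-monoˡ-≤ (suc d) (ℕ.*-monoˡ-≤ f m+2≤n)) ⟩
  (n ℕ.* A ℕ.+ f) ℕ.* n ℕ.+ (n ℕ.* f) ℕ.* suc d
    ≡⟨ regroup n A f d ⟩
  n ℕ.* (A ℕ.* n ℕ.+ f ℕ.* suc (suc d))
    ≤⟨ ℕ.*-monoʳ-≤ n (partialSumNumerator-potential-≤ n m (suc d) (trans (ℕ.+-suc m (suc d)) eq)) ⟩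
  n ℕ.* n ^ suc m ∎
  where
  open ℕ.≤-Reasoning
  A = partialSumNumerator n m
  f = suc m !
  m+2≤n : suc (suc m) ℕ.≤ n
  m+2≤n = subst (suc (suc m) ℕ.≤_) eq (ℕ.m<m+n (suc m) z<s)
  regroup : ∀ n a f d →
    (n ℕ.* a ℕ.+ f) ℕ.* n ℕ.+ (n ℕ.* f) ℕ.* suc d ≡ n ℕ.* (a ℕ.* n ℕ.+ f ℕ.* suc (suc d))
  regroup = solve-∀

partialSumNumerator-≤ : ∀ n → partialSumNumerator n n ℕ.≤ n ^ n
partialSumNumerator-≤ zero    = ℕ.z≤n
partialSumNumerator-≤ (suc k) = begin
  n ℕ.* A ℕ.+ n !        ≡⟨ cong₂ ℕ._+_ (ℕ.*-comm n A) (sym (ℕ.*-identityʳ (n !))) ⟩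
  A ℕ.* n ℕ.+ n ! ℕ.* 1  ≤⟨ partialSumNumerator-potential-≤ n k 0 (ℕ.+-comm k 1) ⟩
  n ^ n                  ∎
  where
  open ℕ.≤-Reasoning
  n = suc k
  A = partialSumNumerator n k

+a/d≤1 : ∀ a d .{{_ : NonZero d}} → a ℕ.≤ d → (+ a) U./ d U.≤ U.1ℚᵘ
+a/d≤1 a d@(suc _) a≤d =
  *≤* (subst₂ ℤ._≤_ (sym (ℤ.*-identityʳ (+ a))) (sym (ℤ.*-identityˡ (+ d))) (ℤ.+≤+ a≤d))

corollary3p6 : (n : ℕ) → .{{_ : NonZero n}} → partialSum n n ≤ 1ℚ
corollary3p6 n = toℚᵘ-cancel-≤ (U.≤-respˡ-≃ (U.≃-sym (toℚᵘ-partialSum n n))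
  (+a/d≤1 (partialSumNumerator n n) (n ^ n) {{ℕ.m^n≢0 n n}} (partialSumNumerator-≤ n)))
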